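{- Let $\mathcal{G}$ be a finite simple graph with vertex set $\mathcal{V}$, let $\mathcal{A}\subseteq\mathcal{V}$ and let $\eta$ be an automorphism of $\mathcal{G}$. Then $\gamma_{\mathcal{A}}(\mathcal{G})=\gamma_{\eta(\mathcal{A})}(\mathcal{G})$.
   Context: Orbits: $\mathcal{O}(y)=\{\pi(y):\pi\in\mathrm{Aut}(\mathcal{G})\}$. For $\mathcal{A}\subseteq\mathcal{V}$, $x\equiv_{\mathcal{A}}y$ iff $\mathcal{O}(x)\cap\mathcal{A}=\mathcal{O}(y)\cap\mathcal{A}$, and $\gamma_{\mathcal{A}}(\mathcal{G})$ is the partition of $\mathcal{V}$ into the equivalence classes of $\equiv_{\mathcal{A}}$. -}

module Defs where

open import Data.Nat using (ℕ)
open import Data.Fin using (Fin)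
open import Data.Product using (Σ; ∃; _×_; _,_)
open import Data.Empty using (⊥)
open import Relation.Nullary using (¬_)
open import Relation.Binary.PropositionalEquality using (_≡_)
open import Function.Bundles using (Bijection; _⇔_)
open import Function using (_⤖_)

record SimpleGraph (n : ℕ) : Set₁ where
  field
    Adj       : Fin n → Fin n → Set
    irrefl    : ∀ x → ¬ Adj x x
    sym       : ∀ {x y} → Adj x y → Adj y x

open SimpleGraph public

VSubset : ℕ → Set₁
VSubset n = Fin n → Set

record Automorphism {n : ℕ} (G : SimpleGraph n) : Set where
  field
    perm    : Fin n ⤖ Fin n
    adj-iff : ∀ x y → Adj G x y ⇔ Adj G (Bijection.to perm x) (Bijection.to perm y)

open Automorphism public

app : ∀ {n} {G : SimpleGraph n} → Automorphism G → Fin n → Fin n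
app η = Bijection.to (perm η)

Orbit : ∀ {n} (G : SimpleGraph n) → Fin n → VSubset n
Orbit G y z = Σ (Automorphism G) (λ π → app π y ≡ z)

image : ∀ {n} {G : SimpleGraph n} → Automorphism G → VSubset n → VSubset n
image η A z = Σ (Fin _) (λ a → A a × app η a ≡ z)

_≐_ : ∀ {n} → VSubset n → VSubset n → Set
P ≐ Q = ∀ z → P z ⇔ Q z

_∩_ : ∀ {n} → VSubset n → VSubset n → VSubset n
(P ∩ Q) z = P z × Q z

EquivA : ∀ {n} (G : SimpleGraph n) → VSubset n → Fin n → Fin n → Set
EquivA G A x y = (Orbit G x ∩ A) ≐ (Orbit G y ∩ A)

-- γ_A(G) = γ_B(G): the partitions of V into equivalence classes of ≡_A and ≡_B
-- coincide, i.e. the two equivalence relations coincide (each class of one is a class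
-- of the other iff x ≡_A y ⇔ x ≡_B y for all x, y).
SamePartition : ∀ {n} (G : SimpleGraph n) → VSubset n → VSubset n → Set
SamePartition G A B = ∀ x y → EquivA G A x y ⇔ EquivA G B x y

{-# OPTIONS --safe #-}
module Submission where

-- Automorphisms form a group, so every orbit 𝒪(x) is η-invariant.
-- Hence 𝒪(x) ∩ η(A) = η(𝒪(x) ∩ A), and since η is injective on vertices,
-- η(𝒪(x) ∩ A) = η(𝒪(y) ∩ A) exactly when 𝒪(x) ∩ A = 𝒪(y) ∩ A.

open import Defs
open import Data.Nat using (ℕ)
open import Data.Fin using (Fin)
open import Data.Product using (_,_; proj₂)
open import Relation.Binary.PropositionalEquality using (_≡_; refl; trans; cong; subst; subst₂) renaming (sym to ≡-sym)
open import Function.Bundles using (Bijection; _⇔_; Equivalence; mk⇔)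
open import Function.Construct.Composition using (_⤖-∘_)
open import Function.Construct.Symmetry using (⤖-sym)

≐-sym : {n : ℕ} {P Q : VSubset n} → P ≐ Q → Q ≐ P
≐-sym P≐Q z = mk⇔ (Equivalence.from (P≐Q z)) (Equivalence.to (P≐Q z))

≐-trans : {n : ℕ} {P Q R : VSubset n} → P ≐ Q → Q ≐ R → P ≐ R
≐-trans P≐Q Q≐R z = mk⇔
  (λ p → Equivalence.to (Q≐R z) (Equivalence.to (P≐Q z) p))
  (λ r → Equivalence.from (P≐Q z) (Equivalence.from (Q≐R z) r))

module _ {n : ℕ} {G : SimpleGraph n} where

  private
    module Perm (η : Automorphism G) = Bijection (perm η)

  app-injective : (η : Automorphism G) {x y : Fin n} → app η x ≡ app η y → x ≡ y
  app-injective η = Perm.injective η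

  _∘ᵃ_ : Automorphism G → Automorphism G → Automorphism G
  η ∘ᵃ π = record
    { perm    = perm η ⤖-∘ perm π
    ; adj-iff = λ x y → mk⇔
        (λ a → Equivalence.to (adj-iff η _ _) (Equivalence.to (adj-iff π x y) a))
        (λ a → Equivalence.from (adj-iff π x y) (Equivalence.from (adj-iff η _ _) a))
    }

  app-inverseʳ : (η : Automorphism G) (x : Fin n) → app η (Perm.to⁻ η x) ≡ x
  app-inverseʳ η x = proj₂ (Perm.strictlySurjective η x)

  _⁻¹ᵃ : Automorphism G → Automorphism G
  η ⁻¹ᵃ = record
    { perm    = ⤖-sym (perm η)
    ; adj-iff = λ x y → mk⇔
        (λ a → Equivalence.from (adj-iff η _ _)
                 (subst₂ (Adj G) (≡-sym (app-inverseʳ η x)) (≡-sym (app-inverseʳ η y)) a))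
        (λ a → subst₂ (Adj G) (app-inverseʳ η x) (app-inverseʳ η y)
                 (Equivalence.to (adj-iff η _ _) a))
    }

  app-inverseˡ : (η : Automorphism G) (x : Fin n) → app (η ⁻¹ᵃ) (app η x) ≡ x
  app-inverseˡ η x = app-injective η (app-inverseʳ η (app η x))

  orbit-invariant : (η : Automorphism G) (x z : Fin n) →
                    Orbit G x z ⇔ Orbit G x (app η z)
  orbit-invariant η x z = mk⇔
    (λ { (π , πx≡z) → η ∘ᵃ π , cong (app η) πx≡z })
    (λ { (π , πx≡ηz) → (η ⁻¹ᵃ) ∘ᵃ π ,
           trans (cong (app (η ⁻¹ᵃ)) πx≡ηz) (app-inverseˡ η z) })

  image-∩-invariant : (η : Automorphism G) {P : VSubset n} (A : VSubset n) →
                      (∀ z → P z ⇔ P (app η z)) →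
                      (P ∩ image η A) ≐ image η (P ∩ A)
  image-∩-invariant η {P} A P-inv z = mk⇔
    (λ { (Pz , a , Aa , ηa≡z) →
           a , (Equivalence.from (P-inv a) (subst P (≡-sym ηa≡z) Pz) , Aa) , ηa≡z })
    (λ { (a , (Pa , Aa) , ηa≡z) →
           subst P ηa≡z (Equivalence.to (P-inv a) Pa) , a , Aa , ηa≡z })

  image-mono : (η : Automorphism G) {P Q : VSubset n} →
               (∀ z → P z → Q z) → ∀ z → image η P z → image η Q z
  image-mono η P⊆Q _ (a , Pa , ηa≡z) = a , P⊆Q a Pa , ηa≡z

  image-reflects-⊆ : (η : Automorphism G) {P Q : VSubset n} →
                     (∀ z → image η P z → image η Q z) → ∀ z → P z → Q z
  image-reflects-⊆ η {Q = Q} ηP⊆ηQ z Pz with ηP⊆ηQ (app η z) (z , Pz , refl)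
  ... | a , Qa , ηa≡ηz = subst Q (app-injective η ηa≡ηz) Qa

  image-resp-≐ : (η : Automorphism G) {P Q : VSubset n} →
                 P ≐ Q → image η P ≐ image η Q
  image-resp-≐ η P≐Q z = mk⇔
    (image-mono η (λ w → Equivalence.to (P≐Q w)) z)
    (image-mono η (λ w → Equivalence.from (P≐Q w)) z)

  image-cancel-≐ : (η : Automorphism G) {P Q : VSubset n} →
                   image η P ≐ image η Q → P ≐ Q
  image-cancel-≐ η ηP≐ηQ z = mk⇔
    (image-reflects-⊆ η (λ w → Equivalence.to (ηP≐ηQ w)) z)
    (image-reflects-⊆ η (λ w → Equivalence.from (ηP≐ηQ w)) z)

  orbit-∩-image : (η : Automorphism G) (A : VSubset n) (x : Fin n) →
                  (Orbit G x ∩ image η A) ≐ image η (Orbit G x ∩ A)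
  orbit-∩-image η A x = image-∩-invariant η A (orbit-invariant η x)

proposition1p0p7 : (n : ℕ) (G : SimpleGraph n) (A : VSubset n) (η : Automorphism G) →
    SamePartition G A (image η A)
proposition1p0p7 n G A η x y = mk⇔
  (λ x∼y → ≐-trans (orbit-∩-image η A x)
             (≐-trans (image-resp-≐ η x∼y) (≐-sym (orbit-∩-image η A y))))
  (λ x∼y → image-cancel-≐ η
             (≐-trans (≐-sym (orbit-∩-image η A x)) (≐-trans x∼y (orbit-∩-image η A y))))
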